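{- Let $n,k,s$ be positive integers with $k \ge s+2$ and $k+s<n$. Then \[ \max_{U\subset V(C_n^s),\ |U|=k} e(U) = sk - \frac{s(s+1)}{2}. \]
   Context: $C_n^s$ is the graph on vertex set $\mathbb{Z}/n\mathbb{Z}$ in which distinct $i,j$ (represented in $\{1,\dots,n\}$) are adjacent iff $\min(|i-j|, n-|i-j|)\le s$; i.e. the $s$-th power of the cycle $C_n$. For a vertex subset $U$, $e(U)$ denotes the number of edges of the induced subgraph on $U$. -}

module Defs where

open import Data.Nat using (ℕ; zero; suc; _+_; _*_; _∸_; _≤_; _<_; _≤?_; _<?_)
open import Data.Nat.Properties using (≤-total)
open import Data.Fin using (Fin; toℕ)
open import Data.Fin.Subset using (Subset; _∈_)
open import Data.Fin.Subset.Properties using (_∈?_)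
open import Data.List using (List; length; filter; allFin; concatMap; map)
open import Data.Product using (_×_; _,_; proj₁; proj₂)
open import Relation.Nullary using (Dec; yes; no; ¬_)
open import Relation.Nullary.Decidable using (_×-dec_)
open import Relation.Unary using (Decidable)

absDiff : ℕ → ℕ → ℕ
absDiff a b = (a ∸ b) + (b ∸ a)

min' : ℕ → ℕ → ℕ
min' a b with a ≤? b
... | yes _ = a
... | no _  = b

-- cyclic distance on Z/nZ, vertices represented by Fin n (i.e. 0..n-1;
-- the shift from {1..n} does not change |i-j|)
cycDist : (n : ℕ) → Fin n → Fin n → ℕ
cycDist n i j = min' (absDiff (toℕ i) (toℕ j)) (n ∸ absDiff (toℕ i) (toℕ j))

-- adjacency in C_n^s (for distinct i, j): cyclic distance ≤ s
Adj : (n s : ℕ) → Fin n → Fin n → Set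
Adj n s i j = cycDist n i j ≤ s

pairs : (n : ℕ) → List (Fin n × Fin n)
pairs n = concatMap (λ i → map (λ j → (i , j)) (allFin n)) (allFin n)

EdgeIn : (n s : ℕ) → Subset n → Fin n × Fin n → Set
EdgeIn n s U (i , j) = (toℕ i < toℕ j) × ((i ∈ U) × ((j ∈ U) × Adj n s i j))

edgeIn? : (n s : ℕ) (U : Subset n) → Decidable (EdgeIn n s U)
edgeIn? n s U (i , j) =
  (toℕ i <? toℕ j) ×-dec ((i ∈? U) ×-dec ((j ∈? U) ×-dec (cycDist n i j ≤? s)))

e : (n s : ℕ) → Subset n → ℕ
e n s U = length (filter (edgeIn? n s U) (pairs n))

-- Upper bound, by induction on k.  For k = s + 1 it is just e(U) ≤ C(k,2).  Otherwise rotate so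
-- that 0 ∈ U and delete vertex 0, identifying the remaining n − 1 vertices with C_{n−1}^s; no edge
-- is lost since cyclic distances only shrink.  The neighbours of 0 are 1..s and n−s..n−1, and for
-- t < s the pair {1+t, n−s+t} has distance s + 1 in C_n^s but s in C_{n−1}^s.  So each such pair
-- inside U that gives 0 a neighbour beyond the first s is paid for by a new edge:
-- e_n(U) ≤ s + e_{n−1}(U − 0), and induction gives e(U) ≤ s + s(k − 1) − s(s+1)/2.
-- Lower bound: k consecutive vertices span Σ_{j<k} min(j, s) = sk − s(s+1)/2 edges, with no
-- wrap-around edge because k + s < n.
module Submission where

open import Defs
open import Data.Nat using (ℕ; zero; suc; _+_; _*_; _∸_; _≤_; _<_; _≤ᵇ_; _<ᵇ_; _⊓_; z≤n; s≤s; z<s; s<s)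
open import Data.Nat.DivMod using (_/_; m*n/n≡m)
open import Data.Nat.Properties
open import Data.Nat.Tactic.RingSolver using (solve-∀)
open import Data.Nat.ListAction using (sum)
open import Data.Nat.ListAction.Properties using (sum-++)
open import Data.Bool using (Bool; true; false; _∧_; _∨_; T; if_then_else_)
open import Data.Bool.Properties using (∨-comm; ∨-zeroʳ; ∨-identityʳ; ∧-zeroʳ; ∧-identityʳ; ∧-commutativeMonoid)
open import Data.Empty using (⊥-elim)
open import Data.Unit using (tt)
open import Data.Product using (_×_; _,_; ∃)
open import Data.Fin using (Fin; toℕ) renaming (zero to fzero; suc to fsuc)
open import Data.Fin.Subset using (Subset; ∣_∣; inside; outside)
open import Data.Fin.Subset.Properties using (_∈?_)
open import Data.Vec using ([]; _∷_)
open import Data.List as List using (List; []; _∷_; length; filter; map; concatMap; tabulate; allFin)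
open import Data.List.Properties using (map-++; map-∘; map-tabulate)
open import Function using (_∘_; id)
open import Relation.Binary.PropositionalEquality
open import Relation.Nullary using (yes; no; does)
open import Relation.Nullary.Decidable using (dec-true; dec-false)
open import Relation.Unary using (Decidable)
open import Algebra.Bundles using (CommutativeMonoid)
open import Algebra.Properties.CommutativeSemigroup +-commutativeSemigroup using (interchange)
open import Algebra.Properties.CommutativeSemigroup (CommutativeMonoid.commutativeSemigroup ∧-commutativeMonoid)
  using () renaming (x∙yz≈y∙xz to ∧-swap)

∑< : ℕ → (ℕ → ℕ) → ℕ
∑< zero    f = 0
∑< (suc n) f = f 0 + ∑< n (f ∘ suc)

syntax ∑< n (λ i → f) = ∑[ i < n ] f

∑-cong : ∀ n {f g : ℕ → ℕ} → (∀ i → i < n → f i ≡ g i) → ∑< n f ≡ ∑< n g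
∑-cong zero    eq = refl
∑-cong (suc n) eq = cong₂ _+_ (eq 0 z<s) (∑-cong n (λ i i<n → eq (suc i) (s<s i<n)))

∑-mono-≤ : ∀ n {f g : ℕ → ℕ} → (∀ i → i < n → f i ≤ g i) → ∑< n f ≤ ∑< n g
∑-mono-≤ zero    le = z≤n
∑-mono-≤ (suc n) le = +-mono-≤ (le 0 z<s) (∑-mono-≤ n (λ i i<n → le (suc i) (s<s i<n)))

∑-zero : ∀ n {f : ℕ → ℕ} → (∀ i → i < n → f i ≡ 0) → ∑< n f ≡ 0
∑-zero zero    eq = refl
∑-zero (suc n) eq rewrite eq 0 z<s = ∑-zero n (λ i i<n → eq (suc i) (s<s i<n))

∑-const : ∀ n c → ∑[ _ < n ] c ≡ n * c
∑-const zero    c = refl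
∑-const (suc n) c = cong (c +_) (∑-const n c)

∑-distrib-+ : ∀ n (f g : ℕ → ℕ) → ∑[ i < n ] (f i + g i) ≡ ∑< n f + ∑< n g
∑-distrib-+ zero    f g = refl
∑-distrib-+ (suc n) f g =
  trans (cong (f 0 + g 0 +_) (∑-distrib-+ n (f ∘ suc) (g ∘ suc))) (interchange (f 0) (g 0) _ _)

∑-*ˡ : ∀ n c (f : ℕ → ℕ) → ∑[ i < n ] (c * f i) ≡ c * ∑< n f
∑-*ˡ zero    c f = sym (*-zeroʳ c)
∑-*ˡ (suc n) c f = trans (cong (c * f 0 +_) (∑-*ˡ n c (f ∘ suc))) (sym (*-distribˡ-+ c (f 0) _))

∑-+ : ∀ m n (f : ℕ → ℕ) → ∑< (m + n) f ≡ ∑< m f + ∑[ i < n ] f (m + i)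
∑-+ zero    n f = refl
∑-+ (suc m) n f = trans (cong (f 0 +_) (∑-+ m n (f ∘ suc))) (sym (+-assoc (f 0) _ _))

∑-snoc : ∀ n (f : ℕ → ℕ) → ∑< (suc n) f ≡ ∑< n f + f n
∑-snoc zero    f = +-identityʳ (f 0)
∑-snoc (suc n) f = trans (cong (f 0 +_) (∑-snoc n (f ∘ suc))) (sym (+-assoc (f 0) _ _))

∑-term-≤ : ∀ n (f : ℕ → ℕ) {i} → i < n → f i ≤ ∑< n f
∑-term-≤ (suc n) f {zero}  _         = m≤m+n (f 0) _
∑-term-≤ (suc n) f {suc i} (s<s i<n) = ≤-trans (∑-term-≤ n (f ∘ suc) i<n) (m≤n+m _ (f 0))

∑-mono-≤-length : ∀ {m n} (f : ℕ → ℕ) → m ≤ n → ∑< m f ≤ ∑< n f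
∑-mono-≤-length f z≤n       = z≤n
∑-mono-≤-length f (s≤s m≤n) = +-monoʳ-≤ (f 0) (∑-mono-≤-length (f ∘ suc) m≤n)

∑-+-∸ : ∀ n {f g : ℕ → ℕ} → (∀ i → i < n → f i ≤ g i) → ∑< n f + ∑[ i < n ] (g i ∸ f i) ≡ ∑< n g
∑-+-∸ n {f} le = trans (sym (∑-distrib-+ n f _)) (∑-cong n (λ i i<n → m+[n∸m]≡n (le i i<n)))

∑-graph-≤ : ∀ m n (u : ℕ → ℕ → ℕ) {g : ℕ → ℕ} → (∀ a → a < m → g a < n) →
            ∑[ a < m ] u a (g a) ≤ ∑[ a < m ] ∑[ b < n ] u a b
∑-graph-≤ m n u g<n = ∑-mono-≤ m (λ a a<m → ∑-term-≤ n (u a) (g<n a a<m))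

𝟙 : Bool → ℕ
𝟙 true  = 1
𝟙 false = 0

𝟙-∧ : ∀ p q → 𝟙 (p ∧ q) ≡ 𝟙 p * 𝟙 q
𝟙-∧ true  q = sym (+-identityʳ (𝟙 q))
𝟙-∧ false q = refl

𝟙-∧-≤ˡ : ∀ p q → 𝟙 (p ∧ q) ≤ 𝟙 p
𝟙-∧-≤ˡ true  true  = ≤-refl
𝟙-∧-≤ˡ true  false = z≤n
𝟙-∧-≤ˡ false q     = z≤n

𝟙-∧-≤ʳ : ∀ p q → 𝟙 (p ∧ q) ≤ 𝟙 q
𝟙-∧-≤ʳ true  q = ≤-refl
𝟙-∧-≤ʳ false q = z≤n

𝟙-+-≤ : ∀ p q → 𝟙 p + 𝟙 q ≤ 1 + 𝟙 (p ∧ q)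
𝟙-+-≤ true  q = ≤-refl
𝟙-+-≤ false true  = ≤-refl
𝟙-+-≤ false false = z≤n

∑-𝟙-+-≤ : ∀ n (p q : ℕ → Bool) → ∑[ t < n ] 𝟙 (p t) + ∑[ t < n ] 𝟙 (q t) ≤ n + ∑[ t < n ] 𝟙 (p t ∧ q t)
∑-𝟙-+-≤ n p q = begin
  ∑[ t < n ] 𝟙 (p t) + ∑[ t < n ] 𝟙 (q t) ≡⟨ sym (∑-distrib-+ n (𝟙 ∘ p) (𝟙 ∘ q)) ⟩
  ∑[ t < n ] (𝟙 (p t) + 𝟙 (q t))          ≤⟨ ∑-mono-≤ n (λ t _ → 𝟙-+-≤ (p t) (q t)) ⟩
  ∑[ t < n ] (1 + 𝟙 (p t ∧ q t))          ≡⟨ ∑-distrib-+ n (λ _ → 1) _ ⟩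
  ∑[ _ < n ] 1 + ∑[ t < n ] 𝟙 (p t ∧ q t) ≡⟨ cong (_+ ∑[ t < n ] 𝟙 (p t ∧ q t)) (trans (∑-const n 1) (*-identityʳ n)) ⟩
  n + ∑[ t < n ] 𝟙 (p t ∧ q t)            ∎
  where open ≤-Reasoning

𝟙-mono : ∀ {p q} → (T p → T q) → 𝟙 p ≤ 𝟙 q
𝟙-mono {false}         _   = z≤n
𝟙-mono {true}  {true}  _   = ≤-refl
𝟙-mono {true}  {false} p⇒q = ⊥-elim (p⇒q tt)

∧-monoʳ-T : ∀ c {p q} → (T p → T q) → T (c ∧ p) → T (c ∧ q)
∧-monoʳ-T true  p⇒q = p⇒q
∧-monoʳ-T false p⇒q = id

∨-monoʳ-T : ∀ c {p q} → (T p → T q) → T (c ∨ p) → T (c ∨ q)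
∨-monoʳ-T true  p⇒q = id
∨-monoʳ-T false p⇒q = p⇒q

≤ᵇ-true : ∀ {m n} → m ≤ n → (m ≤ᵇ n) ≡ true
≤ᵇ-true {m} {n} = dec-true (m ≤? n)

≤ᵇ-false : ∀ {m n} → n < m → (m ≤ᵇ n) ≡ false
≤ᵇ-false {m} {n} n<m = dec-false (m ≤? n) (<⇒≱ n<m)

<ᵇ-true : ∀ {m n} → m < n → (m <ᵇ n) ≡ true
<ᵇ-true {m} {n} = dec-true (m <? n)

<ᵇ-false : ∀ {m n} → n ≤ m → (m <ᵇ n) ≡ false
<ᵇ-false {m} {n} n≤m = dec-false (m <? n) (≤⇒≯ n≤m)

≤ᵇ-antimono : ∀ {m n} s → m ≤ n → T (n ≤ᵇ s) → T (m ≤ᵇ s)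
≤ᵇ-antimono {m} {n} s m≤n n≤s = ≤⇒≤ᵇ (≤-trans m≤n (≤ᵇ⇒≤ n s n≤s))

≤ᵇ-∨-≤ᵇ : ∀ {p q} s → p ≤ q → (p ≤ᵇ s) ∨ (q ≤ᵇ s) ≡ (p ≤ᵇ s)
≤ᵇ-∨-≤ᵇ {p} {q} s p≤q with p ≤? s
... | yes p≤s rewrite ≤ᵇ-true p≤s = refl
... | no  p≰s rewrite ≤ᵇ-false (≰⇒> p≰s) | ≤ᵇ-false (<-≤-trans (≰⇒> p≰s) p≤q) = refl

min'-≤ᵇ : ∀ p q s → (min' p q ≤ᵇ s) ≡ (p ≤ᵇ s) ∨ (q ≤ᵇ s)
min'-≤ᵇ p q s with p ≤? q
... | yes p≤q = sym (≤ᵇ-∨-≤ᵇ s p≤q)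
... | no  p≰q = trans (sym (≤ᵇ-∨-≤ᵇ s (<⇒≤ (≰⇒> p≰q)))) (∨-comm (q ≤ᵇ s) (p ≤ᵇ s))

choose2 : ℕ → ℕ
choose2 k = ∑[ i < k ] i

choose2-suc : ∀ k → choose2 (suc k) ≡ k + choose2 k
choose2-suc k = trans (∑-distrib-+ k (λ _ → 1) id) (cong (_+ choose2 k) (trans (∑-const k 1) (*-identityʳ k)))

choose2-double : ∀ n → choose2 (suc n) + choose2 (suc n) ≡ n * suc n
choose2-double zero    = refl
choose2-double (suc n) = begin
  choose2 (suc (suc n)) + choose2 (suc (suc n)) ≡⟨ cong₂ _+_ (choose2-suc (suc n)) (choose2-suc (suc n)) ⟩
  (suc n + choose2 (suc n)) + (suc n + choose2 (suc n)) ≡⟨ interchange (suc n) _ (suc n) _ ⟩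
  (suc n + suc n) + (choose2 (suc n) + choose2 (suc n)) ≡⟨ cong (suc n + suc n +_) (choose2-double n) ⟩
  (suc n + suc n) + n * suc n                           ≡⟨ gauss-step n ⟩
  suc n * suc (suc n)                                   ∎
  where
  open ≡-Reasoning
  gauss-step : ∀ n → (suc n + suc n) + n * suc n ≡ suc n * suc (suc n)
  gauss-step = solve-∀

choose2-half : ∀ s → s * (s + 1) / 2 ≡ choose2 (suc s)
choose2-half s = begin
  s * (s + 1) / 2                         ≡⟨ cong (λ t → s * t / 2) (+-comm s 1) ⟩
  s * suc s / 2                           ≡⟨ cong (_/ 2) (sym (choose2-double s)) ⟩
  (choose2 (suc s) + choose2 (suc s)) / 2 ≡⟨ cong (_/ 2) (double≡*2 (choose2 (suc s))) ⟩
  choose2 (suc s) * 2 / 2                 ≡⟨ m*n/n≡m (choose2 (suc s)) 2 ⟩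
  choose2 (suc s)                         ∎
  where
  open ≡-Reasoning
  double≡*2 : ∀ c → c + c ≡ c * 2
  double≡*2 = solve-∀

absDiff-≤ : ∀ {a b} → a ≤ b → absDiff a b ≡ b ∸ a
absDiff-≤ {a} {b} a≤b = cong (_+ (b ∸ a)) (m≤n⇒m∸n≡0 a≤b)

absDiff-+ : ∀ d a → absDiff a (d + a) ≡ d
absDiff-+ d a = trans (absDiff-≤ (m≤n+m a d)) (m+n∸n≡m d a)

absDiff-≤ʳ : ∀ {a b} → a ≤ b → absDiff a b ≤ b
absDiff-≤ʳ {a} {b} a≤b = ≤-trans (≤-reflexive (absDiff-≤ a≤b)) (m∸n≤m b a)

adjacentᵇ : (N s a b : ℕ) → Bool
adjacentᵇ N s a b = (absDiff a b ≤ᵇ s) ∨ (N ∸ absDiff a b ≤ᵇ s)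

adjacentᵇ-direct : ∀ {N s} a b → s < N ∸ absDiff a b → adjacentᵇ N s a b ≡ (absDiff a b ≤ᵇ s)
adjacentᵇ-direct a b s<N∸d rewrite ≤ᵇ-false s<N∸d = ∨-identityʳ _

nonadjacent : ∀ {N s} a b → s < absDiff a b → s < N ∸ absDiff a b → adjacentᵇ N s a b ≡ false
nonadjacent a b s<d s<N∸d = trans (adjacentᵇ-direct a b s<N∸d) (≤ᵇ-false s<d)

adjacentᵇ-around : ∀ {N s} a b → N ∸ absDiff a b ≤ s → adjacentᵇ N s a b ≡ true
adjacentᵇ-around a b N∸d≤s rewrite ≤ᵇ-true N∸d≤s = ∨-zeroʳ _

adjacentᵇ-complement : ∀ {N s} a b a′ b′ → absDiff a′ b′ ≡ N ∸ absDiff a b → absDiff a b ≤ N →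
                       adjacentᵇ N s a′ b′ ≡ adjacentᵇ N s a b
adjacentᵇ-complement {N} {s} a b a′ b′ d′≡N∸d d≤N = begin
  (absDiff a′ b′ ≤ᵇ s) ∨ (N ∸ absDiff a′ b′ ≤ᵇ s) ≡⟨ cong (λ e → (e ≤ᵇ s) ∨ (N ∸ e ≤ᵇ s)) d′≡N∸d ⟩
  (N ∸ d ≤ᵇ s) ∨ (N ∸ (N ∸ d) ≤ᵇ s)              ≡⟨ cong (λ e → (N ∸ d ≤ᵇ s) ∨ (e ≤ᵇ s)) (m∸[m∸n]≡n d≤N) ⟩
  (N ∸ d ≤ᵇ s) ∨ (d ≤ᵇ s)                        ≡⟨ ∨-comm (N ∸ d ≤ᵇ s) (d ≤ᵇ s) ⟩
  adjacentᵇ N s a b                              ∎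
  where
  open ≡-Reasoning
  d : ℕ
  d = absDiff a b

adjacentᵇ-shrink : ∀ {M N} s a b → M ≤ N → T (adjacentᵇ N s a b) → T (adjacentᵇ M s a b)
adjacentᵇ-shrink {M} {N} s a b M≤N = ∨-monoʳ-T (absDiff a b ≤ᵇ s) (≤ᵇ-antimono s (∸-monoˡ-≤ (absDiff a b) M≤N))

edgeᵇ : (N s : ℕ) → (ℕ → Bool) → ℕ → ℕ → Bool
edgeᵇ N s x a b = (a <ᵇ b) ∧ (x a ∧ (x b ∧ adjacentᵇ N s a b))

-- Vertex sets are indicators x : ℕ → Bool, so that shifting and rotating them is composition;
-- edges N s x M counts the edges of C_N^s between members of x below M.
edges : (N s : ℕ) → (ℕ → Bool) → ℕ → ℕ
edges N s x M = ∑[ a < M ] ∑[ b < M ] 𝟙 (edgeᵇ N s x a b)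

size : (ℕ → Bool) → ℕ → ℕ
size x M = ∑[ a < M ] 𝟙 (x a)

edges-cong : ∀ N s M {x y : ℕ → Bool} → (∀ a → a < M → x a ≡ y a) → edges N s x M ≡ edges N s y M
edges-cong N s M x≗y = ∑-cong M (λ a a<M → ∑-cong M (λ b b<M →
  cong₂ (λ p q → 𝟙 ((a <ᵇ b) ∧ (p ∧ (q ∧ adjacentᵇ N s a b)))) (x≗y a a<M) (x≗y b b<M)))

size-cong : ∀ M {x y : ℕ → Bool} → (∀ a → a < M → x a ≡ y a) → size x M ≡ size y M
size-cong M x≗y = ∑-cong M (λ a a<M → cong 𝟙 (x≗y a a<M))

edges-suc : ∀ N s x M →
  edges N s x (suc M) ≡ ∑[ b < M ] 𝟙 (x 0 ∧ (x (suc b) ∧ adjacentᵇ N s 0 (suc b))) + edges N s (x ∘ suc) M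
edges-suc N s x M = refl

edges-snoc : ∀ N s x M → edges N s x (suc M) ≡ edges N s x M + ∑[ a < M ] 𝟙 (edgeᵇ N s x a M)
edges-snoc N s x M = begin
  edges N s x (suc M)
    ≡⟨ ∑-snoc M _ ⟩
  ∑[ a < M ] ∑[ b < suc M ] 𝟙 (edgeᵇ N s x a b) + ∑[ b < suc M ] 𝟙 (edgeᵇ N s x M b)
    ≡⟨ cong₂ _+_ (∑-cong M (λ a _ → ∑-snoc M _)) (∑-zero (suc M) no-forward-edge) ⟩
  ∑[ a < M ] (∑[ b < M ] 𝟙 (edgeᵇ N s x a b) + 𝟙 (edgeᵇ N s x a M)) + 0
    ≡⟨ +-identityʳ _ ⟩
  ∑[ a < M ] (∑[ b < M ] 𝟙 (edgeᵇ N s x a b) + 𝟙 (edgeᵇ N s x a M))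
    ≡⟨ ∑-distrib-+ M _ _ ⟩
  edges N s x M + ∑[ a < M ] 𝟙 (edgeᵇ N s x a M) ∎
  where
  open ≡-Reasoning
  no-forward-edge : ∀ b → b < suc M → 𝟙 (edgeᵇ N s x M b) ≡ 0
  no-forward-edge b (s≤s b≤M) rewrite <ᵇ-false {M} {b} b≤M = refl

edges-≤-choose2 : ∀ N s x M → edges N s x M ≤ choose2 (size x M)
edges-≤-choose2 N s x zero    = z≤n
edges-≤-choose2 N s x (suc M) = begin
  edges N s x (suc M)
    ≡⟨ edges-suc N s x M ⟩
  ∑[ b < M ] 𝟙 (x 0 ∧ (x (suc b) ∧ adjacentᵇ N s 0 (suc b))) + edges N s (x ∘ suc) M
    ≤⟨ +-mono-≤ (∑-mono-≤ M (λ b _ → edge-≤-product (x 0) (x (suc b)) _)) (edges-≤-choose2 N s (x ∘ suc) M) ⟩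
  ∑[ b < M ] (𝟙 (x 0) * 𝟙 (x (suc b))) + choose2 (size (x ∘ suc) M)
    ≡⟨ cong (_+ choose2 (size (x ∘ suc) M)) (∑-*ˡ M (𝟙 (x 0)) (𝟙 ∘ x ∘ suc)) ⟩
  𝟙 (x 0) * size (x ∘ suc) M + choose2 (size (x ∘ suc) M)
    ≡⟨ choose2-𝟙+ (x 0) (size (x ∘ suc) M) ⟩
  choose2 (size x (suc M)) ∎
  where
  open ≤-Reasoning
  edge-≤-product : ∀ p q r → 𝟙 (p ∧ (q ∧ r)) ≤ 𝟙 p * 𝟙 q
  edge-≤-product p q r rewrite 𝟙-∧ p (q ∧ r) = *-monoʳ-≤ (𝟙 p) (𝟙-∧-≤ˡ q r)
  choose2-𝟙+ : ∀ p k → 𝟙 p * k + choose2 k ≡ choose2 (𝟙 p + k)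
  choose2-𝟙+ true  k = trans (cong (_+ choose2 k) (+-identityʳ k)) (sym (choose2-suc k))
  choose2-𝟙+ false k = refl

edges-beyond : ∀ N s x M d → (∀ a → M ≤ a → x a ≡ false) → edges N s x (M + d) ≡ edges N s x M
edges-beyond N s x M zero    outside-M = cong (edges N s x) (+-identityʳ M)
edges-beyond N s x M (suc d) outside-M = begin
  edges N s x (M + suc d)                                   ≡⟨ cong (edges N s x) (+-suc M d) ⟩
  edges N s x (suc (M + d))                                 ≡⟨ edges-snoc N s x (M + d) ⟩
  edges N s x (M + d) + ∑[ a < M + d ] 𝟙 (edgeᵇ N s x a (M + d)) ≡⟨ cong₂ _+_ (edges-beyond N s x M d outside-M) (∑-zero (M + d) no-edge) ⟩
  edges N s x M + 0                                         ≡⟨ +-identityʳ _ ⟩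
  edges N s x M                                             ∎
  where
  open ≡-Reasoning
  no-edge : ∀ a → a < M + d → 𝟙 (edgeᵇ N s x a (M + d)) ≡ 0
  no-edge a _ rewrite outside-M (M + d) (m≤m+n M d) | ∧-zeroʳ (x a) | ∧-zeroʳ (a <ᵇ M + d) = refl

indicator : ∀ {n} → Subset n → ℕ → Bool
indicator []      _       = false
indicator (b ∷ U) zero    = b
indicator (b ∷ U) (suc a) = indicator U a

∣∣≡size : ∀ {n} (U : Subset n) → ∣ U ∣ ≡ size (indicator U) n
∣∣≡size []          = refl
∣∣≡size (true  ∷ U) = cong suc (∣∣≡size U)
∣∣≡size (false ∷ U) = ∣∣≡size U

does-∈? : ∀ {n} (U : Subset n) i → does (i ∈? U) ≡ indicator U (toℕ i)
does-∈? (true  ∷ U) fzero    = refl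
does-∈? (false ∷ U) fzero    = refl
does-∈? (b     ∷ U) (fsuc i) = does-∈? U i

does-edgeIn? : ∀ n s (U : Subset n) i j → does (edgeIn? n s U (i , j)) ≡ edgeᵇ n s (indicator U) (toℕ i) (toℕ j)
does-edgeIn? n s U i j =
  cong₂ (λ p q → (toℕ i <ᵇ toℕ j) ∧ (p ∧ q)) (does-∈? U i) (cong₂ _∧_ (does-∈? U j) (min'-≤ᵇ d (n ∸ d) s))
  where
  d : ℕ
  d = absDiff (toℕ i) (toℕ j)

length-filter : ∀ {A : Set} {P : A → Set} (P? : Decidable P) xs → length (filter P? xs) ≡ sum (map (𝟙 ∘ does ∘ P?) xs)
length-filter P? []       = refl
length-filter P? (x ∷ xs) with does (P? x)
... | true  = cong suc (length-filter P? xs)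
... | false = length-filter P? xs

sum-map-concatMap : ∀ {A B : Set} (g : B → ℕ) (f : A → List B) xs →
                    sum (map g (concatMap f xs)) ≡ sum (map (sum ∘ map g ∘ f) xs)
sum-map-concatMap g f []       = refl
sum-map-concatMap g f (x ∷ xs) = begin
  sum (map g (f x List.++ concatMap f xs))              ≡⟨ cong sum (map-++ g (f x) _) ⟩
  sum (map g (f x) List.++ map g (concatMap f xs))      ≡⟨ sum-++ (map g (f x)) _ ⟩
  sum (map g (f x)) + sum (map g (concatMap f xs))      ≡⟨ cong (sum (map g (f x)) +_) (sum-map-concatMap g f xs) ⟩
  sum (map g (f x)) + sum (map (sum ∘ map g ∘ f) xs)    ∎
  where open ≡-Reasoning

sum-tabulate : ∀ n {g : Fin n → ℕ} {G : ℕ → ℕ} → (∀ i → g i ≡ G (toℕ i)) → sum (tabulate g) ≡ ∑< n G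
sum-tabulate zero    g≗G = refl
sum-tabulate (suc n) g≗G = cong₂ _+_ (g≗G fzero) (sum-tabulate n (g≗G ∘ fsuc))

sum-map-allFin : ∀ n {g : Fin n → ℕ} {G : ℕ → ℕ} → (∀ i → g i ≡ G (toℕ i)) → sum (map g (allFin n)) ≡ ∑< n G
sum-map-allFin n {g} g≗G = trans (cong sum (map-tabulate id g)) (sum-tabulate n g≗G)

e≡edges : ∀ n s (U : Subset n) → e n s U ≡ edges n s (indicator U) n
e≡edges n s U = begin
  length (filter P? (pairs n))                ≡⟨ length-filter P? (pairs n) ⟩
  sum (map w (concatMap row (allFin n)))      ≡⟨ sum-map-concatMap w row (allFin n) ⟩
  sum (map (sum ∘ map w ∘ row) (allFin n))    ≡⟨ sum-map-allFin n (λ i → trans (cong sum (sym (map-∘ (allFin n))))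
                                                                        (sum-map-allFin n (λ j → cong 𝟙 (does-edgeIn? n s U i j)))) ⟩
  edges n s (indicator U) n                   ∎
  where
  open ≡-Reasoning
  P? : Decidable (EdgeIn n s U)
  P? = edgeIn? n s U
  w : Fin n × Fin n → ℕ
  w = 𝟙 ∘ does ∘ P?
  row : Fin n → List (Fin n × Fin n)
  row i = map (i ,_) (allFin n)

-- Upper bound

rotate : ℕ → (ℕ → Bool) → ℕ → Bool
rotate M x i = if i <ᵇ M then x (suc i) else x 0

rotate-below : ∀ {M} x {i} → i < M → rotate M x i ≡ x (suc i)
rotate-below x i<M rewrite <ᵇ-true i<M = refl

rotate-top : ∀ M x → rotate M x M ≡ x 0
rotate-top M x rewrite <ᵇ-false {M} ≤-refl = refl

edges-rotate : ∀ s M x → edges (suc M) s (rotate M x) (suc M) ≡ edges (suc M) s x (suc M)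
edges-rotate s M x = begin
  edges N s y (suc M)
    ≡⟨ edges-snoc N s y M ⟩
  edges N s y M + ∑[ a < M ] 𝟙 (edgeᵇ N s y a M)
    ≡⟨ cong₂ _+_ (edges-cong N s M (λ a → rotate-below x)) (∑-cong M closing-edge) ⟩
  edges N s (x ∘ suc) M + ∑[ b < M ] 𝟙 (x 0 ∧ (x (suc b) ∧ adjacentᵇ N s 0 (suc b)))
    ≡⟨ +-comm (edges N s (x ∘ suc) M) _ ⟩
  edges N s x (suc M) ∎
  where
  open ≡-Reasoning
  N : ℕ
  N = suc M
  y : ℕ → Bool
  y = rotate M x
  closing-edge : ∀ a → a < M → 𝟙 (edgeᵇ N s y a M) ≡ 𝟙 (x 0 ∧ (x (suc a) ∧ adjacentᵇ N s 0 (suc a)))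
  closing-edge a a<M = cong 𝟙 (begin
    (a <ᵇ M) ∧ (y a ∧ (y M ∧ adjacentᵇ N s a M))
      ≡⟨ cong (_∧ (y a ∧ (y M ∧ adjacentᵇ N s a M))) (<ᵇ-true a<M) ⟩
    y a ∧ (y M ∧ adjacentᵇ N s a M)
      ≡⟨ cong₂ (λ p q → p ∧ (q ∧ adjacentᵇ N s a M)) (rotate-below x a<M) (rotate-top M x) ⟩
    x (suc a) ∧ (x 0 ∧ adjacentᵇ N s a M)
      ≡⟨ cong (λ r → x (suc a) ∧ (x 0 ∧ r)) (sym (adjacentᵇ-complement a M 0 (suc a) (sym N∸d≡1+a) d≤N)) ⟩
    x (suc a) ∧ (x 0 ∧ adjacentᵇ N s 0 (suc a))
      ≡⟨ ∧-swap (x (suc a)) (x 0) _ ⟩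
    x 0 ∧ (x (suc a) ∧ adjacentᵇ N s 0 (suc a)) ∎)
    where
    d≤N : absDiff a M ≤ N
    d≤N = ≤-trans (absDiff-≤ʳ (<⇒≤ a<M)) (n≤1+n M)
    N∸d≡1+a : N ∸ absDiff a M ≡ suc a
    N∸d≡1+a = begin
      N ∸ absDiff a M     ≡⟨ cong (N ∸_) (absDiff-≤ (<⇒≤ a<M)) ⟩
      suc M ∸ (M ∸ a)     ≡⟨ +-∸-assoc 1 (m∸n≤m M a) ⟩
      suc (M ∸ (M ∸ a))   ≡⟨ cong suc (m∸[m∸n]≡n (<⇒≤ a<M)) ⟩
      suc a               ∎

size-rotate : ∀ M x → size (rotate M x) (suc M) ≡ size x (suc M)
size-rotate M x = begin
  size (rotate M x) (suc M)               ≡⟨ ∑-snoc M _ ⟩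
  size (rotate M x) M + 𝟙 (rotate M x M)  ≡⟨ cong₂ _+_ (size-cong M (λ a → rotate-below x)) (cong 𝟙 (rotate-top M x)) ⟩
  size (x ∘ suc) M + 𝟙 (x 0)              ≡⟨ +-comm (size (x ∘ suc) M) _ ⟩
  size x (suc M)                          ∎
  where open ≡-Reasoning

rotate-to-front : ∀ s M x p → p ≤ M → x p ≡ true →
  ∃ λ y → y 0 ≡ true × edges (suc M) s y (suc M) ≡ edges (suc M) s x (suc M) × size y (suc M) ≡ size x (suc M)
rotate-to-front s M x zero    _   x0≡true = x , x0≡true , refl , refl
rotate-to-front s M x (suc p) p<M xp≡true
  with rotate-to-front s M (rotate M x) p (<⇒≤ p<M) (trans (rotate-below x p<M) xp≡true)
... | y , y0≡true , edges≡ , size≡ = y , y0≡true , trans edges≡ (edges-rotate s M x) , trans size≡ (size-rotate M x)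

size-pos⇒member : ∀ M x → 0 < size x M → ∃ λ p → p < M × x p ≡ true
size-pos⇒member (suc M) x 0<size with x 0 in x0≡
... | true  = 0 , z<s , x0≡
... | false with size-pos⇒member M (x ∘ suc) 0<size
...   | p , p<M , xp≡true = suc p , s<s p<M , xp≡true

-- C_N^s with N = M + 1 and M = s + L + s loses vertex 0, and its vertices 1..M become the
-- vertices 0..M − 1 of C_M^s.  The pairs (t, far t), t < s, are at cyclic distance s in C_M^s
-- but s + 1 in C_N^s.
module Contraction (s L : ℕ) where

  M : ℕ
  M = s + (L + s)

  N : ℕ
  N = suc M

  far : ℕ → ℕ
  far t = s + (L + t)

  degree-0-≤ : ∀ (x : ℕ → Bool) → ∑[ b < M ] 𝟙 (x 0 ∧ (x (suc b) ∧ adjacentᵇ N s 0 (suc b)))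
                     ≤ ∑[ t < s ] 𝟙 (x (suc t)) + ∑[ t < s ] 𝟙 (x (suc (far t)))
  degree-0-≤ x = begin
    ∑< M f                                                   ≡⟨ ∑-+ s (L + s) f ⟩
    ∑< s f + ∑[ t < L + s ] f (s + t)                        ≡⟨ cong (∑< s f +_) (∑-+ L s (λ t → f (s + t))) ⟩
    ∑< s f + (∑[ t < L ] f (s + t) + ∑[ t < s ] f (far t))
      ≤⟨ +-mono-≤ (∑-mono-≤ s (λ t _ → f≤member t))
                  (+-mono-≤ (≤-reflexive (∑-zero L gap-empty)) (∑-mono-≤ s (λ t _ → f≤member (far t)))) ⟩
    ∑[ t < s ] 𝟙 (x (suc t)) + ∑[ t < s ] 𝟙 (x (suc (far t))) ∎
    where
    open ≤-Reasoning
    f : ℕ → ℕ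
    f b = 𝟙 (x 0 ∧ (x (suc b) ∧ adjacentᵇ N s 0 (suc b)))
    f≤member : ∀ b → f b ≤ 𝟙 (x (suc b))
    f≤member b = ≤-trans (𝟙-∧-≤ʳ (x 0) (x (suc b) ∧ adj)) (𝟙-∧-≤ˡ (x (suc b)) adj)
      where
      adj : Bool
      adj = adjacentᵇ N s 0 (suc b)
    s<M∸[s+t] : ∀ t → t < L → s < M ∸ (s + t)
    s<M∸[s+t] t t<L = begin-strict
      s                 <⟨ m<n+m s (m<n⇒0<n∸m t<L) ⟩
      (L ∸ t) + s       ≡⟨ sym (+-∸-comm s (<⇒≤ t<L)) ⟩
      (L + s) ∸ t       ≡⟨ sym ([m+n]∸[m+o]≡n∸o s (L + s) t) ⟩
      M ∸ (s + t)       ∎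
    gap-empty : ∀ t → t < L → f (s + t) ≡ 0
    gap-empty t t<L
      rewrite nonadjacent {N} 0 (suc (s + t)) (s≤s (m≤m+n s t)) (s<M∸[s+t] t t<L)
            | ∧-zeroʳ (x (suc (s + t))) | ∧-zeroʳ (x 0) = refl

  edges-shrink : 1 ≤ L → ∀ (y : ℕ → Bool) → edges N s y M + ∑[ t < s ] 𝟙 (y t ∧ y (far t)) ≤ edges M s y M
  edges-shrink 1≤L y = begin
    edges N s y M + ∑[ t < s ] 𝟙 (y t ∧ y (far t))
      ≡⟨ cong (edges N s y M +_) (∑-cong s (λ t _ → sym (gain-far t))) ⟩
    edges N s y M + ∑[ t < s ] gain t (far t)
      ≤⟨ +-monoʳ-≤ (edges N s y M) (≤-trans (∑-graph-≤ s M gain far<M) (∑-mono-≤-length _ (m≤m+n s (L + s)))) ⟩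
    edges N s y M + ∑[ a < M ] ∑[ b < M ] gain a b
      ≡⟨ sym (∑-distrib-+ M _ _) ⟩
    ∑[ a < M ] (∑[ b < M ] edge N a b + ∑[ b < M ] gain a b)
      ≡⟨ ∑-cong M (λ a _ → ∑-+-∸ M (λ b _ → edge-mono a b)) ⟩
    edges M s y M ∎
    where
    open ≤-Reasoning
    edge : ℕ → ℕ → ℕ → ℕ
    edge K a b = 𝟙 (edgeᵇ K s y a b)
    gain : ℕ → ℕ → ℕ
    gain a b = edge M a b ∸ edge N a b
    edge-mono : ∀ a b → edge N a b ≤ edge M a b
    edge-mono a b = 𝟙-mono (∧-monoʳ-T (a <ᵇ b) (∧-monoʳ-T (y a) (∧-monoʳ-T (y b) (adjacentᵇ-shrink s a b (n≤1+n M)))))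
    far<M : ∀ t → t < s → far t < M
    far<M t t<s = +-monoʳ-< s (+-monoʳ-< L t<s)
    t<far : ∀ t → t < far t
    t<far t = <-≤-trans (m<n+m t 1≤L) (m≤n+m (L + t) s)
    M≡s+L+s : M ≡ (s + L) + s
    M≡s+L+s = sym (+-assoc s L s)
    M∸[s+L] : M ∸ (s + L) ≡ s
    M∸[s+L] = trans (cong (_∸ (s + L)) M≡s+L+s) (m+n∸m≡n (s + L) s)
    N∸[s+L] : N ∸ (s + L) ≡ suc s
    N∸[s+L] = trans (+-∸-assoc 1 (≤-trans (m≤m+n (s + L) s) (≤-reflexive (sym M≡s+L+s)))) (cong suc M∸[s+L])
    d≡s+L : ∀ t → absDiff t (far t) ≡ s + L
    d≡s+L t = trans (cong (absDiff t) (sym (+-assoc s L t))) (absDiff-+ (s + L) t)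
    adjacent-in-M : ∀ t → adjacentᵇ M s t (far t) ≡ true
    adjacent-in-M t = adjacentᵇ-around t (far t) (≤-reflexive (trans (cong (M ∸_) (d≡s+L t)) M∸[s+L]))
    nonadjacent-in-N : ∀ t → adjacentᵇ N s t (far t) ≡ false
    nonadjacent-in-N t = nonadjacent t (far t)
      (subst (s <_) (sym (d≡s+L t)) (m<m+n s 1≤L))
      (subst (s <_) (sym (trans (cong (N ∸_) (d≡s+L t)) N∸[s+L])) ≤-refl)
    gain-far : ∀ t → gain t (far t) ≡ 𝟙 (y t ∧ y (far t))
    gain-far t
      rewrite <ᵇ-true (t<far t) | adjacent-in-M t | nonadjacent-in-N t
            | ∧-identityʳ (y (far t)) | ∧-zeroʳ (y (far t)) | ∧-zeroʳ (y t) = refl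

  contract-0 : 1 ≤ L → ∀ (x : ℕ → Bool) → edges N s x N ≤ s + edges M s (x ∘ suc) M
  contract-0 1≤L x = begin
    edges N s x N
      ≡⟨ edges-suc N s x M ⟩
    ∑[ b < M ] 𝟙 (x 0 ∧ (y b ∧ adjacentᵇ N s 0 (suc b))) + edges N s y M
      ≤⟨ +-monoˡ-≤ (edges N s y M) (degree-0-≤ x) ⟩
    (∑[ t < s ] 𝟙 (y t) + ∑[ t < s ] 𝟙 (y (far t))) + edges N s y M
      ≤⟨ +-monoˡ-≤ (edges N s y M) (∑-𝟙-+-≤ s y (y ∘ far)) ⟩
    (s + wrapped) + edges N s y M
      ≡⟨ +-assoc s wrapped _ ⟩
    s + (wrapped + edges N s y M)
      ≡⟨ cong (s +_) (+-comm wrapped _) ⟩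
    s + (edges N s y M + wrapped)
      ≤⟨ +-monoʳ-≤ s (edges-shrink 1≤L y) ⟩
    s + edges M s y M ∎
    where
    open ≤-Reasoning
    y : ℕ → Bool
    y = x ∘ suc
    wrapped : ℕ
    wrapped = ∑[ t < s ] 𝟙 (y t ∧ y (far t))

edges-contract : ∀ s M x → s + s < M → edges (suc M) s x (suc M) ≤ s + edges M s (x ∘ suc) M
edges-contract s M x 2s<M with m≤n⇒∃[o]m+o≡n 2s<M
... | o , refl = subst (λ K → edges (suc K) s x (suc K) ≤ s + edges K s (x ∘ suc) K)
                       (layout s o) (Contraction.contract-0 s (suc o) (s≤s z≤n) x)
  where
  layout : ∀ s o → s + (suc o + s) ≡ suc (s + s) + o
  layout = solve-∀

edges-upper : ∀ s d N x → size x N ≡ suc s + d → suc s + d + s < N →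
              edges N s x N + choose2 (suc s) ≤ s * (suc s + d)
edges-upper s zero N x size≡ _ = begin
  edges N s x N + choose2 (suc s)      ≤⟨ +-monoˡ-≤ (choose2 (suc s)) (edges-≤-choose2 N s x N) ⟩
  choose2 (size x N) + choose2 (suc s) ≡⟨ cong (λ k → choose2 k + choose2 (suc s)) (trans size≡ (+-identityʳ (suc s))) ⟩
  choose2 (suc s) + choose2 (suc s)    ≡⟨ choose2-double s ⟩
  s * suc s                            ≡⟨ cong (s *_) (sym (+-identityʳ (suc s))) ⟩
  s * (suc s + 0)                      ∎
  where open ≤-Reasoning
edges-upper s (suc d) (suc M) x size≡ bound
  with size-pos⇒member (suc M) x (subst (0 <_) (sym size≡) z<s)
... | p , p<N , xp≡true
  with rotate-to-front s M x p (≤-pred p<N) xp≡true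
... | y , y0≡true , edges≡ , size-y≡ = begin
  edges (suc M) s x (suc M) + c   ≡⟨ cong (_+ c) (sym edges≡) ⟩
  edges (suc M) s y (suc M) + c   ≤⟨ +-monoˡ-≤ c (edges-contract s M y 2s<M) ⟩
  (s + edges M s (y ∘ suc) M) + c ≡⟨ +-assoc s _ c ⟩
  s + (edges M s (y ∘ suc) M + c) ≤⟨ +-monoʳ-≤ s (edges-upper s d M (y ∘ suc) size-tail bound-tail) ⟩
  s + s * (suc s + d)             ≡⟨ sym (*-suc s (suc s + d)) ⟩
  s * suc (suc s + d)             ≡⟨ cong (s *_) (sym (+-suc (suc s) d)) ⟩
  s * (suc s + suc d)             ∎
  where
  open ≤-Reasoning
  c : ℕ
  c = choose2 (suc s)
  size-tail : size (y ∘ suc) M ≡ suc s + d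
  size-tail = suc-injective (begin-equality
    suc (size (y ∘ suc) M)       ≡⟨ cong (λ b → 𝟙 b + size (y ∘ suc) M) (sym y0≡true) ⟩
    size y (suc M)               ≡⟨ trans size-y≡ size≡ ⟩
    suc s + suc d                ≡⟨ +-suc (suc s) d ⟩
    suc (suc s + d)              ∎)
  bound-tail : suc s + d + s < M
  bound-tail = ≤-pred (subst (_< suc M) (cong (_+ s) (+-suc (suc s) d)) bound)
  2s<M : s + s < M
  2s<M = ≤-trans (s≤s (+-monoˡ-≤ s (m≤m+n s d))) (<⇒≤ bound-tail)

-- Initial segments

∑𝟙[j∸a≤s]≡j⊓s : ∀ s j → ∑[ a < j ] 𝟙 (j ∸ a ≤ᵇ s) ≡ j ⊓ s
∑𝟙[j∸a≤s]≡j⊓s s zero    = refl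
∑𝟙[j∸a≤s]≡j⊓s s (suc j) with suc j ≤? s
... | yes 1+j≤s rewrite ≤ᵇ-true 1+j≤s | ∑𝟙[j∸a≤s]≡j⊓s s j =
  trans (cong suc (m≤n⇒m⊓n≡m (<⇒≤ 1+j≤s))) (sym (m≤n⇒m⊓n≡m 1+j≤s))
... | no  1+j≰s rewrite ≤ᵇ-false (≰⇒> 1+j≰s) | ∑𝟙[j∸a≤s]≡j⊓s s j =
  trans (m≥n⇒m⊓n≡n (≤-pred (≰⇒> 1+j≰s))) (sym (m≥n⇒m⊓n≡n (<⇒≤ (≰⇒> 1+j≰s))))

∑⊓-closed-form : ∀ s d → ∑[ j < suc s + d ] (j ⊓ s) + choose2 (suc s) ≡ s * (suc s + d)
∑⊓-closed-form s d = begin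
  ∑[ j < suc s + d ] (j ⊓ s) + c
    ≡⟨ cong (_+ c) (∑-+ (suc s) d (_⊓ s)) ⟩
  (∑[ j < suc s ] (j ⊓ s) + ∑[ i < d ] ((suc s + i) ⊓ s)) + c
    ≡⟨ cong₂ (λ u v → (u + v) + c) (∑-cong (suc s) (λ j j<1+s → m≤n⇒m⊓n≡m (≤-pred j<1+s)))
                                   (trans (∑-cong d (λ i _ → m≥n⇒m⊓n≡n (≤-trans (n≤1+n s) (m≤m+n (suc s) i))))
                                          (∑-const d s)) ⟩
  (c + d * s) + c
    ≡⟨ rearrange c (d * s) ⟩
  (c + c) + d * s
    ≡⟨ cong (_+ d * s) (choose2-double s) ⟩
  s * suc s + d * s
    ≡⟨ distrib s d ⟩
  s * (suc s + d) ∎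
  where
  open ≡-Reasoning
  c : ℕ
  c = choose2 (suc s)
  rearrange : ∀ c e → (c + e) + c ≡ (c + c) + e
  rearrange = solve-∀
  distrib : ∀ s d → s * suc s + d * s ≡ s * (suc s + d)
  distrib = solve-∀

size-below : ∀ N k → k ≤ N → size (_<ᵇ k) N ≡ k
size-below N       zero    _         = ∑-zero N (λ _ _ → refl)
size-below (suc N) (suc k) (s≤s k≤N) = cong suc (size-below N k k≤N)

n<k⇒k+m<o⇒m<o∸n : ∀ {m n k o} → n < k → k + m < o → m < o ∸ n
n<k⇒k+m<o⇒m<o∸n {m} {n} {k} {o} n<k k+m<o = m+n≤o⇒m≤o∸n (suc m) (begin
  suc m + n ≡⟨ sym (+-suc m n) ⟩
  m + suc n ≤⟨ +-monoʳ-≤ m n<k ⟩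
  m + k     ≡⟨ +-comm m k ⟩
  k + m     <⟨ k+m<o ⟩
  o         ∎)
  where open ≤-Reasoning

edges-below-prefix : ∀ N s k M → k + s < N → M ≤ k → edges N s (_<ᵇ k) M ≡ ∑[ j < M ] (j ⊓ s)
edges-below-prefix N s k zero    _     _   = refl
edges-below-prefix N s k (suc M) k+s<N M<k = begin
  edges N s χ (suc M)                            ≡⟨ edges-snoc N s χ M ⟩
  edges N s χ M + ∑[ a < M ] 𝟙 (edgeᵇ N s χ a M) ≡⟨ cong₂ _+_ (edges-below-prefix N s k M k+s<N (<⇒≤ M<k)) (∑-cong M closing-edge) ⟩
  ∑[ j < M ] (j ⊓ s) + ∑[ a < M ] 𝟙 (M ∸ a ≤ᵇ s) ≡⟨ cong (∑[ j < M ] (j ⊓ s) +_) (∑𝟙[j∸a≤s]≡j⊓s s M) ⟩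
  ∑[ j < M ] (j ⊓ s) + M ⊓ s                     ≡⟨ sym (∑-snoc M (_⊓ s)) ⟩
  ∑[ j < suc M ] (j ⊓ s)                         ∎
  where
  open ≡-Reasoning
  χ : ℕ → Bool
  χ = _<ᵇ k
  closing-edge : ∀ a → a < M → 𝟙 (edgeᵇ N s χ a M) ≡ 𝟙 (M ∸ a ≤ᵇ s)
  closing-edge a a<M
    rewrite <ᵇ-true a<M | <ᵇ-true (<-trans a<M M<k) | <ᵇ-true M<k
          | adjacentᵇ-direct {N} {s} a M (n<k⇒k+m<o⇒m<o∸n (≤-trans (s≤s (absDiff-≤ʳ (<⇒≤ a<M))) M<k) k+s<N)
          | absDiff-≤ (<⇒≤ a<M) = refl

initial : (n k : ℕ) → Subset n
initial zero    k       = []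
initial (suc n) zero    = outside ∷ initial n zero
initial (suc n) (suc k) = inside ∷ initial n k

indicator-initial : ∀ n k a → a < n → indicator (initial n k) a ≡ (a <ᵇ k)
indicator-initial (suc n) zero    zero    _         = refl
indicator-initial (suc n) zero    (suc a) (s<s a<n) = indicator-initial n zero a a<n
indicator-initial (suc n) (suc k) zero    _         = refl
indicator-initial (suc n) (suc k) (suc a) (s<s a<n) = indicator-initial n k a a<n

∣initial∣ : ∀ n k → k ≤ n → ∣ initial n k ∣ ≡ k
∣initial∣ n k k≤n = trans (∣∣≡size (initial n k)) (trans (size-cong n (indicator-initial n k)) (size-below n k k≤n))

e-initial : ∀ n s k → k + s < n → e n s (initial n k) ≡ ∑[ j < k ] (j ⊓ s)
e-initial n s k k+s<n with m≤n⇒∃[o]m+o≡n (≤-trans (m≤m+n k s) (<⇒≤ k+s<n))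
... | d , k+d≡n = begin
  e n s (initial n k)                   ≡⟨ e≡edges n s (initial n k) ⟩
  edges n s (indicator (initial n k)) n ≡⟨ edges-cong n s n (indicator-initial n k) ⟩
  edges n s (_<ᵇ k) n                   ≡⟨ cong (edges n s (_<ᵇ k)) (sym k+d≡n) ⟩
  edges n s (_<ᵇ k) (k + d)             ≡⟨ edges-beyond n s (_<ᵇ k) k d (λ a k≤a → <ᵇ-false k≤a) ⟩
  edges n s (_<ᵇ k) k                   ≡⟨ edges-below-prefix n s k k k+s<n ≤-refl ⟩
  ∑[ j < k ] (j ⊓ s)                    ∎
  where open ≡-Reasoning

mainTheorem5 : (n k s : ℕ) → 1 ≤ n → 1 ≤ k → 1 ≤ s → s + 2 ≤ k → k + s < n →
    ((U : Subset n) → ∣ U ∣ ≡ k → e n s U ≤ s * k ∸ (s * (s + 1)) / 2)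
    × ∃ (λ (U : Subset n) → (∣ U ∣ ≡ k) × (e n s U ≡ s * k ∸ (s * (s + 1)) / 2))
mainTheorem5 n k s _ _ _ s+2≤k k+s<n with m≤n⇒∃[o]m+o≡n (≤-trans (n≤1+n (suc s)) (≤-trans (≤-reflexive (+-comm 2 s)) s+2≤k))
... | d , refl rewrite choose2-half s = upper , initial n k , ∣initial∣ n k k≤n , lower
  where
  c : ℕ
  c = choose2 (suc s)
  k≤n : k ≤ n
  k≤n = ≤-trans (m≤m+n k s) (<⇒≤ k+s<n)
  upper : (U : Subset n) → ∣ U ∣ ≡ k → e n s U ≤ s * k ∸ c
  upper U ∣U∣≡k = m+n≤o⇒m≤o∸n (e n s U)
    (subst (λ m → m + c ≤ s * k) (sym (e≡edges n s U))
           (edges-upper s d n (indicator U) (trans (sym (∣∣≡size U)) ∣U∣≡k) k+s<n))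
  lower : e n s (initial n k) ≡ s * k ∸ c
  lower = trans (e-initial n s k k+s<n) (trans (sym (m+n∸n≡m _ c)) (cong (_∸ c) (∑⊓-closed-form s d)))
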